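{- Let $p,q$ be distinct primes, $n,m$ positive integers, $G=\mathrm{El}(p^n)\times\mathrm{El}(q^m)$, $\alpha=\frac{p^n-1}{p-1}$ and $\beta=\frac{q^m-1}{q-1}$. Let $\langle (a_1,e)\rangle,\dots,\langle(a_\alpha,e)\rangle$ be the distinct subgroups of order $p$ and $\langle (e,b_1)\rangle,\dots,\langle(e,b_\beta)\rangle$ the distinct subgroups of order $q$ of $G$. Define $U_1=\{(e,e)\}$, $V_i=\langle(a_i,e)\rangle\setminus\{(e,e)\}$, $W_{i,j}=\langle (a_i,b_j)\rangle\setminus(\langle(a_i,e)\rangle\cup\langle(e,b_j)\rangle)$ and $X_j=\langle(e,b_j)\rangle\setminus\{(e,e)\}$ for $i\in\{1,\dots,\alpha\}$, $j\in\{1,\dots,\beta\}$. Then \[ \{U_1,V_1,\dots,V_\alpha,W_{1,1},\dots,W_{1,\beta},\dots,W_{\alpha,1},\dots,W_{\alpha,\beta},X_1,\dots,X_\beta\} \] is an equitable partition of the power graph $\mathcal{P}(G)$.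
   Context: $\mathrm{El}(p^n)$ denotes the elementary abelian group of order $p^n$; $e$ denotes the identity element. For a group $G$, the power graph $\mathcal{P}(G)$ is the simple graph with vertex set $G$ in which distinct $a,b$ are adjacent if and only if $a=b^k$ or $b=a^k$ for some positive integer $k$. A partition $\{V_1,\dots,V_r\}$ of the vertex set of a graph is equitable if for every $i,j$ and all $u,v\in V_i$ one has $|N(u)\cap V_j|=|N(v)\cap V_j|$, where $N(u)$ is the set of neighbours of $u$. -}

module Defs where

open import Data.Nat using (ℕ; zero; suc; _*_; _∸_; _^_; NonZero)
open import Data.Nat.DivMod using (_/_; _mod_)
open import Data.Fin using (Fin; toℕ)
open import Data.Vec using (Vec; map; replicate)
open import Data.Product using (_×_; _,_; ∃-syntax; Σ)
open import Data.Sum using (_⊎_)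
open import Data.List using (List; length)
open import Data.List.Membership.Propositional using (_∈_)
open import Data.List.Relation.Unary.Unique.Propositional using (Unique)
open import Relation.Binary.PropositionalEquality using (_≡_; _≢_)
open import Relation.Nullary using (¬_)

-- Elementary abelian group El(p^n), modelled as (Z/p)^n, written additively.
El : ℕ → ℕ → Set
El p n = Vec (Fin p) n

zeroEl : (p n : ℕ) .{{_ : NonZero p}} → El p n
zeroEl p n = replicate n (0 mod p)

smul : (p : ℕ) {n : ℕ} .{{_ : NonZero p}} → ℕ → El p n → El p n
smul p k = map (λ c → (k * toℕ c) mod p)

G : (p n q m : ℕ) → Set
G p n q m = El p n × El q m

module _ (p n q m : ℕ) .{{_ : NonZero p}} .{{_ : NonZero q}} where

  eG : G p n q m
  eG = zeroEl p n , zeroEl q m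

  gpow : ℕ → G p n q m → G p n q m
  gpow k (x , y) = smul p k x , smul q k y

  Cyc : G p n q m → G p n q m → Set
  Cyc g x = ∃[ k ] (gpow k g ≡ x)

  SameSub : G p n q m → G p n q m → Set
  SameSub g h = ∀ x → (Cyc g x → Cyc h x) × (Cyc h x → Cyc g x)

  Adj : G p n q m → G p n q m → Set
  Adj a b = a ≢ b × ((∃[ k ] (a ≡ gpow (suc k) b)) ⊎ (∃[ k ] (b ≡ gpow (suc k) a)))

-- α = (p^n - 1)/(p - 1)   (p ≥ 2 for primes; value 0 otherwise, irrelevant)
alpha : ℕ → ℕ → ℕ
alpha (suc (suc k)) n = (suc (suc k) ^ n ∸ 1) / suc k
alpha _ _ = 0

HasSize : {A : Set} → (A → Set) → ℕ → Set
HasSize {A} S c = Σ (List A) λ xs → Unique xs × (length xs ≡ c) × (∀ w → (w ∈ xs → S w) × (S w → w ∈ xs))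

data Label (α β : ℕ) : Set where
  U : Label α β
  V : Fin α → Label α β
  W : Fin α → Fin β → Label α β
  X : Fin β → Label α β

IsEquitablePartition : {A L : Set} → (L → A → Set) → (A → A → Set) → Set
IsEquitablePartition {A} {L} cell adj =
  (∀ l → ∃[ x ] cell l x) ×
  (∀ x → ∃[ l ] cell l x) ×
  (∀ l l' x → cell l x → cell l' x → l ≡ l') ×
  (∀ i j u v → cell i u → cell i v → ∀ c →
     HasSize (λ w → adj u w × cell j w) c → HasSize (λ w → adj v w × cell j w) c)

module _ (p n q m : ℕ) .{{_ : NonZero p}} .{{_ : NonZero q}}
         (a : Fin (alpha p n) → El p n) (b : Fin (alpha q m) → El q m) where

  private
    e : G p n q m
    e = eG p n q m
    ⟨_⟩∋_ : G p n q m → G p n q m → Set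
    ⟨ g ⟩∋ x = Cyc p n q m g x

  cells : Label (alpha p n) (alpha q m) → G p n q m → Set
  cells U x = x ≡ e
  cells (V i) x = (⟨ (a i , zeroEl q m) ⟩∋ x) × x ≢ e
  cells (W i j) x = (⟨ (a i , b j) ⟩∋ x) × ¬ (⟨ (a i , zeroEl q m) ⟩∋ x) × ¬ (⟨ (zeroEl p n , b j) ⟩∋ x)
  cells (X j) x = (⟨ (zeroEl p n , b j) ⟩∋ x) × x ≢ e

-- Each cell is the orbit of its generator g (e, (a_i,e), (a_i,b_j) or (e,b_j))
-- under the powers x ↦ x^s with s a unit modulo both p and q; the Chinese
-- remainder theorem supplies these exponents.  For such a unit K the map
-- x ↦ x^K commutes with all powers, so it is an automorphism of P(G), and it
-- maps every cell into itself.  Hence any two vertices u, v of one cell are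
-- related by an automorphism fixing all cells, which carries the neighbours of
-- u in any cell bijectively onto those of v.
module Submission where

open import Data.Nat using (ℕ; suc; _+_; _*_; _%_; _≥_; NonZero; ≢-nonZero; nonTrivial⇒≢1)
open import Data.Nat.Properties using (*-comm; *-assoc; *-identityˡ; *-identityʳ; *-zeroʳ; +-comm)
open import Data.Nat.DivMod using (_mod_; %-distribˡ-*; m%n%n≡m%n; [m+kn]%n≡m%n; m%n<n; m<n⇒m%n≡m; n%n≡0; m*n%n≡0)
open import Data.Nat.Primality using (Prime; prime⇒irreducible; prime⇒nonTrivial)
open import Data.Nat.Coprimality as Coprime using (Coprime; coprime-Bézout; prime⇒coprime)
open import Data.Nat.GCD using (module Bézout)
open import Data.Nat.Tactic.RingSolver using (solve-∀)
open import Data.Fin using (Fin; toℕ; _≟_)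
open import Data.Fin.Properties using (toℕ-injective; toℕ-fromℕ<; toℕ<n; fromℕ<-cong)
open import Data.Vec using (replicate)
open import Data.Vec.Properties using (map-cong; map-∘; map-id; map-const; map-replicate; ≡-dec)
import Data.List as List
open import Data.List.Properties using (length-map)
open import Data.List.Membership.Propositional using (_∈_)
open import Data.List.Membership.Propositional.Properties using (∈-map⁺; ∈-map⁻)
open import Data.List.Relation.Unary.Unique.Propositional.Properties using (map⁺)
open import Data.Product using (Σ; _×_; _,_; ∃-syntax; proj₁; proj₂)
open import Data.Sum using (inj₁; inj₂)
open import Data.Empty using (⊥-elim)
open import Function using (_∘_; id)
open import Relation.Nullary using (¬_; yes; no)
open import Relation.Binary.PropositionalEquality using (_≡_; _≢_; refl; sym; trans; cong; cong₂; subst; module ≡-Reasoning)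
open import Defs

open ≡-Reasoning

Invertible : (d : ℕ) .{{_ : NonZero d}} → ℕ → Set
Invertible d s = ∃[ s' ] (s' * s) % d ≡ 1 % d

module _ (d : ℕ) .{{_ : NonZero d}} where

  %-cong-* : ∀ {a a' b b'} → a % d ≡ a' % d → b % d ≡ b' % d → (a * b) % d ≡ (a' * b') % d
  %-cong-* {a} {a'} {b} {b'} ha hb = begin
    (a * b) % d                ≡⟨ %-distribˡ-* a b d ⟩
    ((a % d) * (b % d)) % d    ≡⟨ cong₂ (λ x y → (x * y) % d) ha hb ⟩
    ((a' % d) * (b' % d)) % d  ≡⟨ %-distribˡ-* a' b' d ⟨
    (a' * b') % d              ∎

  %-cancel : ∀ {s s'} t → (s' * s) % d ≡ 1 % d → (t * s' * s) % d ≡ t % d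
  %-cancel {s} {s'} t hs = begin
    (t * s' * s) % d    ≡⟨ cong (_% d) (*-assoc t s' s) ⟩
    (t * (s' * s)) % d  ≡⟨ %-cong-* {t} refl hs ⟩
    (t * 1) % d         ≡⟨ cong (_% d) (*-identityʳ t) ⟩
    t % d               ∎

  %-inverse-* : ∀ {s s' t t'} → (s' * s) % d ≡ 1 % d → (t' * t) % d ≡ 1 % d →
                (s' * t' * (t * s)) % d ≡ 1 % d
  %-inverse-* {s} {s'} {t} {t'} hs ht =
    trans (cong (_% d) (rearrange s s' t t')) (%-cong-* ht hs)
    where
    rearrange : ∀ s s' t t' → s' * t' * (t * s) ≡ t' * t * (s' * s)
    rearrange = solve-∀

coprime⇒invertible : ∀ d {s} .{{_ : NonZero d}} → Coprime d s → Invertible d s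
coprime⇒invertible d@(suc d-1) {s} c with coprime-Bézout c
... | Bézout.-+ x y eq = y , (begin
  (y * s) % d      ≡⟨ cong (_% d) eq ⟨
  (1 + x * d) % d  ≡⟨ [m+kn]%n≡m%n 1 x d ⟩
  1 % d            ∎)
... | Bézout.+- x y eq = d-1 * y , (begin
  (d-1 * y * s) % d                  ≡⟨ [m+kn]%n≡m%n (d-1 * y * s) x d ⟨
  (d-1 * y * s + x * d) % d          ≡⟨ cong (λ z → (d-1 * y * s + z) % d) eq ⟨
  (d-1 * y * s + (1 + y * s)) % d    ≡⟨ cong (_% d) (rearrange d-1 y s) ⟩
  (1 + y * s * d) % d                ≡⟨ [m+kn]%n≡m%n 1 (y * s) d ⟩
  1 % d                              ∎)
  where
  rearrange : ∀ d-1 y s → d-1 * y * s + (1 + y * s) ≡ 1 + y * s * suc d-1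
  rearrange = solve-∀

prime⇒invertible : ∀ {d s} .{{_ : NonZero d}} → Prime d → s % d ≢ 0 → Invertible d s
prime⇒invertible {d} {s} pd s≢0 =
  let instance _ = ≢-nonZero s≢0
      (s' , hs) = coprime⇒invertible d (prime⇒coprime pd (m%n<n s d))
  in s' , trans (%-cong-* d {s'} refl (sym (m%n%n≡m%n s d))) hs

distinct-primes⇒coprime : ∀ {p q} → Prime p → Prime q → p ≢ q → Coprime p q
distinct-primes⇒coprime pp qq p≢q (c∣p , c∣q) with prime⇒irreducible pp c∣p
... | inj₁ c≡1 = c≡1
... | inj₂ refl with prime⇒irreducible qq c∣q
...   | inj₁ p≡1 = ⊥-elim (nonTrivial⇒≢1 {{prime⇒nonTrivial pp}} p≡1)
...   | inj₂ p≡q = ⊥-elim (p≢q p≡q)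

-- T = k·(y₁q) + l·(y₂p), where y₁q ≡ 1 (mod p) and y₂p ≡ 1 (mod q).
chinese-remainder : ∀ {p q} .{{_ : NonZero p}} .{{_ : NonZero q}} → Coprime p q →
                    ∀ k l → ∃[ T ] (T % p ≡ k % p × T % q ≡ l % q)
chinese-remainder {p} {q} c k l =
  let (y₁ , h₁) = coprime⇒invertible p c
      (y₂ , h₂) = coprime⇒invertible q (Coprime.sym c)
  in k * (y₁ * q) + l * (y₂ * p) , (begin
    (k * (y₁ * q) + l * (y₂ * p)) % p  ≡⟨ cong (λ z → (k * (y₁ * q) + z) % p) (*-assoc l y₂ p) ⟨
    (k * (y₁ * q) + l * y₂ * p) % p    ≡⟨ [m+kn]%n≡m%n (k * (y₁ * q)) (l * y₂) p ⟩
    (k * (y₁ * q)) % p                 ≡⟨ %-cong-* p {k} refl h₁ ⟩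
    (k * 1) % p                        ≡⟨ cong (_% p) (*-identityʳ k) ⟩
    k % p                              ∎) , (begin
    (k * (y₁ * q) + l * (y₂ * p)) % q  ≡⟨ cong (_% q) (+-comm (k * (y₁ * q)) (l * (y₂ * p))) ⟩
    (l * (y₂ * p) + k * (y₁ * q)) % q  ≡⟨ cong (λ z → (l * (y₂ * p) + z) % q) (*-assoc k y₁ q) ⟨
    (l * (y₂ * p) + k * y₁ * q) % q    ≡⟨ [m+kn]%n≡m%n (l * (y₂ * p)) (k * y₁) q ⟩
    (l * (y₂ * p)) % q                 ≡⟨ %-cong-* q {l} refl h₂ ⟩
    (l * 1) % q                        ≡⟨ cong (_% q) (*-identityʳ l) ⟩
    l % q                              ∎)

module _ {d : ℕ} .{{_ : NonZero d}} where

  private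
    mod-cong : ∀ {a b} → a % d ≡ b % d → a mod d ≡ b mod d
    mod-cong {a} {b} eq = fromℕ<-cong _ _ eq (m%n<n a d) (m%n<n b d)

    toℕ-mod-% : ∀ k → toℕ (k mod d) % d ≡ k % d
    toℕ-mod-% k = trans (cong (_% d) (toℕ-fromℕ< (m%n<n k d))) (m%n%n≡m%n k d)

  smul-cong : ∀ {a b n} → a % d ≡ b % d → (x : El d n) → smul d a x ≡ smul d b x
  smul-cong eq = map-cong (λ c → mod-cong (%-cong-* d eq refl))

  smul-* : ∀ a b {n} (x : El d n) → smul d a (smul d b x) ≡ smul d (a * b) x
  smul-* a b x = trans (sym (map-∘ _ _ x)) (map-cong coordinate x)
    where
    coordinate : ∀ c → (a * toℕ ((b * toℕ c) mod d)) mod d ≡ (a * b * toℕ c) mod d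
    coordinate c = mod-cong (begin
      (a * toℕ ((b * toℕ c) mod d)) % d  ≡⟨ %-cong-* d {a} refl (toℕ-mod-% (b * toℕ c)) ⟩
      (a * (b * toℕ c)) % d              ≡⟨ cong (_% d) (*-assoc a b (toℕ c)) ⟨
      (a * b * toℕ c) % d                ∎)

  smul-identity : ∀ {n} (x : El d n) → smul d 1 x ≡ x
  smul-identity x = trans (map-cong coordinate x) (map-id x)
    where
    coordinate : ∀ c → (1 * toℕ c) mod d ≡ c
    coordinate c = toℕ-injective (begin
      toℕ ((1 * toℕ c) mod d)  ≡⟨ toℕ-fromℕ< (m%n<n (1 * toℕ c) d) ⟩
      (1 * toℕ c) % d          ≡⟨ cong (_% d) (*-identityˡ (toℕ c)) ⟩
      toℕ c % d                ≡⟨ m<n⇒m%n≡m (toℕ<n c) ⟩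
      toℕ c                    ∎)

  smul-%≡0 : ∀ {a n} → a % d ≡ 0 → (x : El d n) → smul d a x ≡ zeroEl d n
  smul-%≡0 {a} a≡0 x = trans (map-cong coordinate x) (map-const x (0 mod d))
    where
    coordinate : ∀ c → (a * toℕ c) mod d ≡ 0 mod d
    coordinate c = mod-cong (trans (%-distribˡ-* a (toℕ c) d)
                                   (cong (λ z → (z * (toℕ c % d)) % d) a≡0))

  smul-zeroEl : ∀ a n → smul d a (zeroEl d n) ≡ zeroEl d n
  smul-zeroEl a n = trans (map-replicate _ (0 mod d) n) (cong (replicate n) (mod-cong (begin
    (a * toℕ (0 mod d)) % d  ≡⟨ %-cong-* d {a} refl (toℕ-mod-% 0) ⟩
    (a * 0) % d              ≡⟨ cong (_% d) (*-zeroʳ a) ⟩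
    0 % d                    ∎)))

HasSize-transport : {A : Set} {S T : A → Set} (f g : A → A) →
  (∀ x → g (f x) ≡ x) → (∀ y → f (g y) ≡ y) →
  (∀ {x} → S x → T (f x)) → (∀ {y} → T y → S (g y)) →
  ∀ {c} → HasSize S c → HasSize T c
HasSize-transport {T = T} f g g∘f f∘g S⇒T T⇒S (xs , unique , len , mem) =
  List.map f xs , map⁺ f-injective unique , trans (length-map f xs) len , λ w → ⇒T w , T⇒ w
  where
  f-injective : ∀ {x y} → f x ≡ f y → x ≡ y
  f-injective {x} {y} eq = trans (sym (g∘f x)) (trans (cong g eq) (g∘f y))

  ⇒T : ∀ w → w ∈ List.map f xs → T w
  ⇒T w w∈ with ∈-map⁻ f w∈
  ... | x , x∈ , refl = S⇒T (proj₁ (mem x) x∈)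

  T⇒ : ∀ w → T w → w ∈ List.map f xs
  T⇒ w tw = subst (_∈ List.map f xs) (f∘g w) (∈-map⁺ f (proj₂ (mem (g w)) (T⇒S tw)))

record Automorphism {A L : Set} (cell : L → A → Set) (adj : A → A → Set) : Set where
  field
    to from   : A → A
    from∘to   : ∀ x → from (to x) ≡ x
    to∘from   : ∀ y → to (from y) ≡ y
    adj-to    : ∀ {x y} → adj x y → adj (to x) (to y)
    adj-from  : ∀ {x y} → adj x y → adj (from x) (from y)
    cell-to   : ∀ {l x} → cell l x → cell l (to x)
    cell-from : ∀ {l x} → cell l x → cell l (from x)

Equitable : {A L : Set} → (L → A → Set) → (A → A → Set) → Set
Equitable cell adj = ∀ i j u v → cell i u → cell i v → ∀ c →
  HasSize (λ w → adj u w × cell j w) c → HasSize (λ w → adj v w × cell j w) c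

transitive-automorphisms⇒equitable : {A L : Set} {cell : L → A → Set} {adj : A → A → Set} →
  (∀ {l u v} → cell l u → cell l v → Σ (Automorphism cell adj) λ φ → Automorphism.to φ u ≡ v) →
  Equitable cell adj
transitive-automorphisms⇒equitable {adj = adj} transitive i j u v cu cv c with transitive cu cv
... | φ , refl = HasSize-transport to from from∘to to∘from
  (λ (u~w , w∈j) → adj-to u~w , cell-to w∈j)
  (λ (v~w , w∈j) → subst (λ z → adj z _) (from∘to u) (adj-from v~w) , cell-from w∈j)
  where open Automorphism φ

module Power (p n q m : ℕ) .{{_ : NonZero p}} .{{_ : NonZero q}} where

  e : G p n q m
  e = eG p n q m

  infixl 8 _^_
  _^_ : G p n q m → ℕ → G p n q m
  g ^ k = gpow p n q m k g

  ⟨_⟩∋_ : G p n q m → G p n q m → Set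
  ⟨ g ⟩∋ x = Cyc p n q m g x

  ι₁ : El p n → G p n q m
  ι₁ α = α , zeroEl q m

  ι₂ : El q m → G p n q m
  ι₂ β = zeroEl p n , β

  ^-cong : ∀ {k l} → k % p ≡ l % p → k % q ≡ l % q → ∀ g → g ^ k ≡ g ^ l
  ^-cong hp hq (α , β) = cong₂ _,_ (smul-cong hp α) (smul-cong hq β)

  ι₁-^-cong : ∀ {k l} → k % p ≡ l % p → ∀ α → ι₁ α ^ k ≡ ι₁ α ^ l
  ι₁-^-cong {k} {l} hp α = cong₂ _,_ (smul-cong hp α) (trans (smul-zeroEl k m) (sym (smul-zeroEl l m)))

  ι₂-^-cong : ∀ {k l} → k % q ≡ l % q → ∀ β → ι₂ β ^ k ≡ ι₂ β ^ l
  ι₂-^-cong {k} {l} hq β = cong₂ _,_ (trans (smul-zeroEl k n) (sym (smul-zeroEl l n))) (smul-cong hq β)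

  ^-*-assoc : ∀ g k l → g ^ l ^ k ≡ g ^ (k * l)
  ^-*-assoc (α , β) k l = cong₂ _,_ (smul-* k l α) (smul-* k l β)

  ^-comm : ∀ g k l → g ^ l ^ k ≡ g ^ k ^ l
  ^-comm g k l = begin
    g ^ l ^ k    ≡⟨ ^-*-assoc g k l ⟩
    g ^ (k * l)  ≡⟨ cong (g ^_) (*-comm k l) ⟩
    g ^ (l * k)  ≡⟨ ^-*-assoc g l k ⟨
    g ^ k ^ l    ∎

  ^-identityʳ : ∀ g → g ^ 1 ≡ g
  ^-identityʳ (α , β) = cong₂ _,_ (smul-identity α) (smul-identity β)

  e-^ : ∀ k → e ^ k ≡ e
  e-^ k = cong₂ _,_ (smul-zeroEl k n) (smul-zeroEl k m)

  proj₁-^-%≡0 : ∀ {k} → k % p ≡ 0 → ∀ g → proj₁ (g ^ k) ≡ zeroEl p n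
  proj₁-^-%≡0 h (α , _) = smul-%≡0 h α

  proj₂-^-%≡0 : ∀ {k} → k % q ≡ 0 → ∀ g → proj₂ (g ^ k) ≡ zeroEl q m
  proj₂-^-%≡0 h (_ , β) = smul-%≡0 h β

  ^-zeroʳ : ∀ g → g ^ 0 ≡ e
  ^-zeroʳ g = cong₂ _,_ (proj₁-^-%≡0 (m*n%n≡0 0 p) g) (proj₂-^-%≡0 (m*n%n≡0 0 q) g)

  ι₁-^-%≡0 : ∀ {k} → k % p ≡ 0 → ∀ α → ι₁ α ^ k ≡ e
  ι₁-^-%≡0 {k} h α = cong₂ _,_ (smul-%≡0 h α) (smul-zeroEl k m)

  ι₂-^-%≡0 : ∀ {k} → k % q ≡ 0 → ∀ β → ι₂ β ^ k ≡ e
  ι₂-^-%≡0 {k} h β = cong₂ _,_ (smul-zeroEl k n) (smul-%≡0 h β)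

  ι₁-proj₁-^ : ∀ g k → ι₁ (proj₁ (g ^ k)) ≡ ι₁ (proj₁ g) ^ k
  ι₁-proj₁-^ _ k = cong₂ _,_ refl (sym (smul-zeroEl k m))

  ι₂-proj₂-^ : ∀ g k → ι₂ (proj₂ (g ^ k)) ≡ ι₂ (proj₂ g) ^ k
  ι₂-proj₂-^ _ k = cong₂ _,_ (sym (smul-zeroEl k n)) refl

  ∋-refl : ∀ g → ⟨ g ⟩∋ g
  ∋-refl g = 1 , ^-identityʳ g

  ∋-e : ∀ g → ⟨ g ⟩∋ e
  ∋-e g = 0 , ^-zeroʳ g

  ∋-trans : ∀ {g h x} → ⟨ g ⟩∋ h → ⟨ h ⟩∋ x → ⟨ g ⟩∋ x
  ∋-trans {g} (k , refl) (l , refl) = l * k , sym (^-*-assoc g l k)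

  ⟨ι₁⟩∋⇒proj₂≡0 : ∀ {α x} → ⟨ ι₁ α ⟩∋ x → proj₂ x ≡ zeroEl q m
  ⟨ι₁⟩∋⇒proj₂≡0 (k , refl) = smul-zeroEl k m

  ⟨ι₂⟩∋⇒proj₁≡0 : ∀ {β x} → ⟨ ι₂ β ⟩∋ x → proj₁ x ≡ zeroEl p n
  ⟨ι₂⟩∋⇒proj₁≡0 (k , refl) = smul-zeroEl k n

  ⟨,⟩∋⇒⟨ι₁⟩∋ : ∀ {α β x} → ⟨ (α , β) ⟩∋ x → proj₂ x ≡ zeroEl q m → ⟨ ι₁ α ⟩∋ x
  ⟨,⟩∋⇒⟨ι₁⟩∋ (k , refl) h = k , cong₂ _,_ refl (trans (smul-zeroEl k m) (sym h))

  ⟨,⟩∋⇒⟨ι₂⟩∋ : ∀ {α β x} → ⟨ (α , β) ⟩∋ x → proj₁ x ≡ zeroEl p n → ⟨ ι₂ β ⟩∋ x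
  ⟨,⟩∋⇒⟨ι₂⟩∋ (k , refl) h = k , cong₂ _,_ (trans (smul-zeroEl k n) (sym h)) refl

  Unit : ℕ → Set
  Unit K = ∃[ K' ] ((K' * K) % p ≡ 1 % p × (K' * K) % q ≡ 1 % q)

  unit-1 : Unit 1
  unit-1 = 1 , refl , refl

  unit-inverse : ∀ {K} (u : Unit K) → Unit (proj₁ u)
  unit-inverse {K} (K' , hp , hq) = K , trans (cong (_% p) (*-comm K K')) hp , trans (cong (_% q) (*-comm K K')) hq

  unit-* : ∀ {s t} → Unit s → Unit t → Unit (t * s)
  unit-* {s} {t} (s' , sp , sq) (t' , tp , tq) =
    s' * t' , %-inverse-* p {s} {s'} {t} {t'} sp tp , %-inverse-* q {s} {s'} {t} {t'} sq tq

  ^-unit-cancel : ∀ {K} (u : Unit K) g → g ^ K ^ proj₁ u ≡ g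
  ^-unit-cancel {K} (K' , hp , hq) g = begin
    g ^ K ^ K'    ≡⟨ ^-*-assoc g K' K ⟩
    g ^ (K' * K)  ≡⟨ ^-cong hp hq g ⟩
    g ^ 1         ≡⟨ ^-identityʳ g ⟩
    g             ∎

  ^-unit-injective : ∀ {K} → Unit K → ∀ {g h} → g ^ K ≡ h ^ K → g ≡ h
  ^-unit-injective u {g} {h} eq =
    trans (sym (^-unit-cancel u g)) (trans (cong (_^ proj₁ u) eq) (^-unit-cancel u h))

  ⟨^unit⟩∋ : ∀ {s} → Unit s → ∀ g → ⟨ g ^ s ⟩∋ g
  ⟨^unit⟩∋ u g = proj₁ u , ^-unit-cancel u g

  ^unit-≡⇒SameSub : ∀ {s t g h} → Unit s → Unit t → g ^ s ≡ h ^ t → SameSub p n q m g h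
  ^unit-≡⇒SameSub {s} {t} {g} {h} us ut gs≡ht x = ∋-trans h∋g , ∋-trans g∋h
    where
    h∋g : ⟨ h ⟩∋ g
    h∋g = ∋-trans (t , refl) (subst (⟨_⟩∋ g) gs≡ht (⟨^unit⟩∋ us g))
    g∋h : ⟨ g ⟩∋ h
    g∋h = ∋-trans (s , refl) (subst (⟨_⟩∋ h) (sym gs≡ht) (⟨^unit⟩∋ ut h))

  ^unit-transitive : ∀ {s t} → Unit s → Unit t → ∀ g → ∃[ K ] Unit K × g ^ s ^ K ≡ g ^ t
  ^unit-transitive {s} {t} us@(s' , sp , sq) ut g = t * s' , unit-* (unit-inverse us) ut , (begin
    g ^ s ^ (t * s')  ≡⟨ ^-*-assoc g (t * s') s ⟩
    g ^ (t * s' * s)  ≡⟨ ^-cong (%-cancel p t sp) (%-cancel q t sq) g ⟩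
    g ^ t             ∎)

  ^unit-preserves-Adj : ∀ {K} → Unit K → ∀ {x y} → Adj p n q m x y → Adj p n q m (x ^ K) (y ^ K)
  ^unit-preserves-Adj {K} u {y = y} (x≢y , inj₁ (k , refl)) =
    x≢y ∘ ^-unit-injective u , inj₁ (k , ^-comm y K (suc k))
  ^unit-preserves-Adj {K} u {x = x} (x≢y , inj₂ (k , refl)) =
    x≢y ∘ ^-unit-injective u , inj₂ (k , ^-comm x K (suc k))

  ^unit-preserves-≢e : ∀ {K} → Unit K → ∀ {x} → x ≢ e → x ^ K ≢ e
  ^unit-preserves-≢e {K} u x≢e xK≡e = x≢e (^-unit-injective u (trans xK≡e (sym (e-^ K))))

  ^unit-preserves-∉ : ∀ {K} → Unit K → ∀ {g x} → ¬ ⟨ g ⟩∋ x → ¬ ⟨ g ⟩∋ (x ^ K)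
  ^unit-preserves-∉ u {g} {x} x∉ xK∈ = x∉ (subst (⟨ g ⟩∋_) (^-unit-cancel u x) (∋-trans xK∈ (proj₁ u , refl)))

  module _ (a : Fin (alpha p n) → El p n) (b : Fin (alpha q m) → El q m) where

    ^unit-preserves-cells : ∀ {K} → Unit K → ∀ {l x} → cells p n q m a b l x → cells p n q m a b l (x ^ K)
    ^unit-preserves-cells {K} u {U} refl = e-^ K
    ^unit-preserves-cells {K} u {V _} (c , x≢e) = ∋-trans c (K , refl) , ^unit-preserves-≢e u x≢e
    ^unit-preserves-cells {K} u {W _ _} (c , ∉ι₁ , ∉ι₂) =
      ∋-trans c (K , refl) , ^unit-preserves-∉ u ∉ι₁ , ^unit-preserves-∉ u ∉ι₂
    ^unit-preserves-cells {K} u {X _} (c , x≢e) = ∋-trans c (K , refl) , ^unit-preserves-≢e u x≢e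

    ^unit-automorphism : ∀ {K} → Unit K → Automorphism (cells p n q m a b) (Adj p n q m)
    ^unit-automorphism {K} u = record
      { to        = _^ K
      ; from      = _^ proj₁ u
      ; from∘to   = ^-unit-cancel u
      ; to∘from   = ^-unit-cancel (unit-inverse u)
      ; adj-to    = ^unit-preserves-Adj u
      ; adj-from  = ^unit-preserves-Adj (unit-inverse u)
      ; cell-to   = ^unit-preserves-cells u
      ; cell-from = ^unit-preserves-cells (unit-inverse u)
      }

module Cells (p n q m : ℕ) .{{_ : NonZero p}} .{{_ : NonZero q}}
  (pp : Prime p) (qq : Prime q) (p≢q : p ≢ q)
  (a : Fin (alpha p n) → El p n) (b : Fin (alpha q m) → El q m)
  (a≢e : ∀ i → (a i , zeroEl q m) ≢ eG p n q m)
  (a-distinct : ∀ i i' → SameSub p n q m (a i , zeroEl q m) (a i' , zeroEl q m) → i ≡ i')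
  (a-complete : ∀ g → g ≢ eG p n q m → gpow p n q m p g ≡ eG p n q m → ∃[ i ] SameSub p n q m g (a i , zeroEl q m))
  (b≢e : ∀ j → (zeroEl p n , b j) ≢ eG p n q m)
  (b-distinct : ∀ j j' → SameSub p n q m (zeroEl p n , b j) (zeroEl p n , b j') → j ≡ j')
  (b-complete : ∀ g → g ≢ eG p n q m → gpow p n q m q g ≡ eG p n q m → ∃[ j ] SameSub p n q m g (zeroEl p n , b j))
  where

  open Power p n q m

  cell : Label (alpha p n) (alpha q m) → G p n q m → Set
  cell = cells p n q m a b

  p⊥q : Coprime p q
  p⊥q = distinct-primes⇒coprime pp qq p≢q

  unit-with-residues : ∀ {s t} → Invertible p s → Invertible q t → ∃[ K ] Unit K × K % p ≡ s % p × K % q ≡ t % q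
  unit-with-residues {s} {t} (s' , hs) (t' , ht) =
    let (K , Kp , Kq) = chinese-remainder p⊥q s t
        (K' , K'p , K'q) = chinese-remainder p⊥q s' t'
    in K , (K' , trans (%-cong-* p K'p Kp) hs , trans (%-cong-* q K'q Kq) ht) , Kp , Kq

  generator : Label (alpha p n) (alpha q m) → G p n q m
  generator U = e
  generator (V i) = ι₁ (a i)
  generator (W i j) = a i , b j
  generator (X j) = ι₂ (b j)

  generator∈cell : ∀ l → cell l (generator l)
  generator∈cell U = refl
  generator∈cell (V i) = ∋-refl _ , a≢e i
  generator∈cell (W i j) = ∋-refl _ , b≢e j ∘ cong ι₂ ∘ ⟨ι₁⟩∋⇒proj₂≡0 , a≢e i ∘ cong ι₁ ∘ ⟨ι₂⟩∋⇒proj₁≡0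
  generator∈cell (X j) = ∋-refl _ , b≢e j

  cell-orbit : ∀ {l x} → cell l x → ∃[ s ] Unit s × generator l ^ s ≡ x
  cell-orbit {U} refl = 1 , unit-1 , e-^ 1
  cell-orbit {V i} ((s , refl) , x≢e) =
    let (K , u , Kp , _) = unit-with-residues {s} {1} (prime⇒invertible pp (λ h → x≢e (ι₁-^-%≡0 h (a i)))) (1 , refl)
    in K , u , ι₁-^-cong Kp (a i)
  cell-orbit {W i j} ((s , refl) , ∉ι₁ , ∉ι₂) =
    let (K , u , Kp , Kq) = unit-with-residues {s} {s} (prime⇒invertible pp s%p≢0) (prime⇒invertible qq s%q≢0)
    in K , u , ^-cong Kp Kq (a i , b j)
    where
    s%p≢0 : s % p ≢ 0
    s%p≢0 h = ∉ι₂ (⟨,⟩∋⇒⟨ι₂⟩∋ (s , refl) (proj₁-^-%≡0 h (a i , b j)))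
    s%q≢0 : s % q ≢ 0
    s%q≢0 h = ∉ι₁ (⟨,⟩∋⇒⟨ι₁⟩∋ (s , refl) (proj₂-^-%≡0 h (a i , b j)))
  cell-orbit {X j} ((s , refl) , x≢e) =
    let (K , u , _ , Kq) = unit-with-residues {1} {s} (1 , refl) (prime⇒invertible qq (λ h → x≢e (ι₂-^-%≡0 h (b j))))
    in K , u , ι₂-^-cong Kq (b j)

  cell-transitive : ∀ {l u v} → cell l u → cell l v → ∃[ K ] Unit K × u ^ K ≡ v
  cell-transitive {l} cu cv with cell-orbit cu | cell-orbit cv
  ... | s , us , refl | t , ut , refl = ^unit-transitive us ut (generator l)

  shared-element⇒SameSub : ∀ l l' {x} → cell l x → cell l' x →
    (f : G p n q m → G p n q m) → (∀ g k → f (g ^ k) ≡ f g ^ k) →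
    SameSub p n q m (f (generator l)) (f (generator l'))
  shared-element⇒SameSub l l' cx cx' f f-^ with cell-orbit cx | cell-orbit cx'
  ... | s , us , gs≡x | t , ut , ht≡x = ^unit-≡⇒SameSub us ut (begin
    f g ^ s    ≡⟨ f-^ g s ⟨
    f (g ^ s)  ≡⟨ cong f (trans gs≡x (sym ht≡x)) ⟩
    f (h ^ t)  ≡⟨ f-^ h t ⟩
    f h ^ t    ∎)
    where
    g = generator l
    h = generator l'

  cells-disjoint : ∀ l l' x → cell l x → cell l' x → l ≡ l'
  cells-disjoint U U _ _ _ = refl
  cells-disjoint U (V _) _ refl (_ , x≢e) = ⊥-elim (x≢e refl)
  cells-disjoint U (W _ _) _ refl (_ , ∉ι₁ , _) = ⊥-elim (∉ι₁ (∋-e _))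
  cells-disjoint U (X _) _ refl (_ , x≢e) = ⊥-elim (x≢e refl)
  cells-disjoint (V _) U _ (_ , x≢e) refl = ⊥-elim (x≢e refl)
  cells-disjoint (V i) (V i') _ cx cx' =
    cong V (a-distinct i i' (shared-element⇒SameSub (V i) (V i') cx cx' id (λ _ _ → refl)))
  cells-disjoint (V _) (W _ _) _ (c , _) (c' , ∉ι₁ , _) = ⊥-elim (∉ι₁ (⟨,⟩∋⇒⟨ι₁⟩∋ c' (⟨ι₁⟩∋⇒proj₂≡0 c)))
  cells-disjoint (V _) (X _) _ (c , x≢e) (c' , _) = ⊥-elim (x≢e (cong₂ _,_ (⟨ι₂⟩∋⇒proj₁≡0 c') (⟨ι₁⟩∋⇒proj₂≡0 c)))
  cells-disjoint (W _ _) U _ (_ , ∉ι₁ , _) refl = ⊥-elim (∉ι₁ (∋-e _))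
  cells-disjoint (W _ _) (V _) _ (c , ∉ι₁ , _) (c' , _) = ⊥-elim (∉ι₁ (⟨,⟩∋⇒⟨ι₁⟩∋ c (⟨ι₁⟩∋⇒proj₂≡0 c')))
  cells-disjoint (W i j) (W i' j') _ cx cx' =
    cong₂ W (a-distinct i i' (shared-element⇒SameSub (W i j) (W i' j') cx cx' (ι₁ ∘ proj₁) ι₁-proj₁-^))
            (b-distinct j j' (shared-element⇒SameSub (W i j) (W i' j') cx cx' (ι₂ ∘ proj₂) ι₂-proj₂-^))
  cells-disjoint (W _ _) (X _) _ (c , _ , ∉ι₂) (c' , _) = ⊥-elim (∉ι₂ (⟨,⟩∋⇒⟨ι₂⟩∋ c (⟨ι₂⟩∋⇒proj₁≡0 c')))
  cells-disjoint (X _) U _ (_ , x≢e) refl = ⊥-elim (x≢e refl)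
  cells-disjoint (X _) (V _) _ (c , _) (c' , x≢e) = ⊥-elim (x≢e (cong₂ _,_ (⟨ι₂⟩∋⇒proj₁≡0 c) (⟨ι₁⟩∋⇒proj₂≡0 c')))
  cells-disjoint (X _) (W _ _) _ (c , _) (c' , _ , ∉ι₂) = ⊥-elim (∉ι₂ (⟨,⟩∋⇒⟨ι₂⟩∋ c' (⟨ι₂⟩∋⇒proj₁≡0 c)))
  cells-disjoint (X j) (X j') _ cx cx' =
    cong X (b-distinct j j' (shared-element⇒SameSub (X j) (X j') cx cx' id (λ _ _ → refl)))

  cells-cover : ∀ x → ∃[ l ] cell l x
  cells-cover (α , β) with ≡-dec _≟_ α (zeroEl p n) | ≡-dec _≟_ β (zeroEl q m)
  ... | yes refl | yes refl = U , refl
  ... | no α≢0 | yes refl =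
    let (i , ⟨α⟩≡⟨aᵢ⟩) = a-complete (ι₁ α) (α≢0 ∘ cong proj₁) (ι₁-^-%≡0 (n%n≡0 p) α)
    in V i , proj₁ (⟨α⟩≡⟨aᵢ⟩ (ι₁ α)) (∋-refl _) , α≢0 ∘ cong proj₁
  ... | yes refl | no β≢0 =
    let (j , ⟨β⟩≡⟨bⱼ⟩) = b-complete (ι₂ β) (β≢0 ∘ cong proj₂) (ι₂-^-%≡0 (n%n≡0 q) β)
    in X j , proj₁ (⟨β⟩≡⟨bⱼ⟩ (ι₂ β)) (∋-refl _) , β≢0 ∘ cong proj₂
  ... | no α≢0 | no β≢0 =
    let (i , ⟨α⟩≡⟨aᵢ⟩) = a-complete (ι₁ α) (α≢0 ∘ cong proj₁) (ι₁-^-%≡0 (n%n≡0 p) α)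
        (j , ⟨β⟩≡⟨bⱼ⟩) = b-complete (ι₂ β) (β≢0 ∘ cong proj₂) (ι₂-^-%≡0 (n%n≡0 q) β)
        (s , aᵢˢ≡α) = proj₁ (⟨α⟩≡⟨aᵢ⟩ (ι₁ α)) (∋-refl _)
        (t , bⱼᵗ≡β) = proj₁ (⟨β⟩≡⟨bⱼ⟩ (ι₂ β)) (∋-refl _)
        (T , Tp , Tq) = chinese-remainder p⊥q s t
    in W i j , (T , cong₂ _,_ (trans (smul-cong Tp (a i)) (cong proj₁ aᵢˢ≡α))
                              (trans (smul-cong Tq (b j)) (cong proj₂ bⱼᵗ≡β))) ,
       β≢0 ∘ ⟨ι₁⟩∋⇒proj₂≡0 , α≢0 ∘ ⟨ι₂⟩∋⇒proj₁≡0

  cells-equitable : Equitable cell (Adj p n q m)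
  cells-equitable = transitive-automorphisms⇒equitable λ cu cv →
    let (K , u , uᴷ≡v) = cell-transitive cu cv in ^unit-automorphism a b u , uᴷ≡v

lemma4p2 : (p q n m : ℕ) .{{_ : NonZero p}} .{{_ : NonZero q}} →
  Prime p → Prime q → p ≢ q → n ≥ 1 → m ≥ 1 →
  (a : Fin (alpha p n) → El p n) → (b : Fin (alpha q m) → El q m) →
  (∀ i → (a i , zeroEl q m) ≢ eG p n q m) →
  (∀ i i' → SameSub p n q m (a i , zeroEl q m) (a i' , zeroEl q m) → i ≡ i') →
  (∀ g → g ≢ eG p n q m → gpow p n q m p g ≡ eG p n q m → ∃[ i ] SameSub p n q m g (a i , zeroEl q m)) →
  (∀ j → (zeroEl p n , b j) ≢ eG p n q m) →
  (∀ j j' → SameSub p n q m (zeroEl p n , b j) (zeroEl p n , b j') → j ≡ j') →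
  (∀ g → g ≢ eG p n q m → gpow p n q m q g ≡ eG p n q m → ∃[ j ] SameSub p n q m g (zeroEl p n , b j)) →
  IsEquitablePartition (cells p n q m a b) (Adj p n q m)
lemma4p2 p q n m pp qq p≢q _ _ a b a≢e a-distinct a-complete b≢e b-distinct b-complete =
  (λ l → generator l , generator∈cell l) , cells-cover , cells-disjoint , cells-equitable
  where open Cells p n q m pp qq p≢q a b a≢e a-distinct a-complete b≢e b-distinct b-complete
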